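{- Let $a,b,r$ be real numbers with $r\neq 0$, and define $f:\mathbb{Z}\to\mathbb{R}$ by $f(n)=ar^n+b\,\dfrac{(-1)^{n+1}}{r^n}$. For integers $n,k$, the signed area $$A=\frac12\det\begin{pmatrix} f(n+2k)-f(n) & f(n+3k)-f(n+k)\\ f(n+4k)-f(n) & f(n+5k)-f(n+k)\end{pmatrix}$$ of the triangle with vertices $(f(n),f(n+k))$, $(f(n+2k),f(n+3k))$, $(f(n+4k),f(n+5k))$ satisfies $$A=\frac{ab(-1)^n}{2}\left(r^k-\frac{1}{r^k}\right)^3\left(r^k+\frac{1}{r^k}\right)\left(r^k+\frac{(-1)^{k+1}}{r^k}\right).$$ -}

module Defs where

open import Level using (Level)
open import Algebra.Bundles using (CommutativeRing)
open import Data.Nat using (ℕ; zero; suc)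
open import Data.Integer using (ℤ; +_; -[1+_]) renaming (_+_ to _ℤ+_; _*_ to _ℤ*_)

-- Notions over an arbitrary commutative ring R (standing in for ℝ).
module _ {c ℓ : Level} (R : CommutativeRing c ℓ) where
  open CommutativeRing R

  pow : Carrier → ℕ → Carrier
  pow x zero    = 1#
  pow x (suc m) = x * pow x m

  -- integer power of a unit x with inverse xi:  x^(+m) = x^m,  x^(-(m+1)) = xi^(m+1)
  zpow : Carrier → Carrier → ℤ → Carrier
  zpow x xi (+ m)      = pow x m
  zpow x xi -[1+ m ]   = pow xi (suc m)

  -- the sign (-1)^n for an integer n  ((-1) is its own inverse)
  sgn : ℤ → Carrier
  sgn n = zpow (- 1#) (- 1#) n

  det2 : Carrier → Carrier → Carrier → Carrier → Carrier
  det2 p q s t = p * t - q * s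

  f : (a b r ri : Carrier) → ℤ → Carrier
  f a b r ri n = a * zpow r ri n + b * (sgn (n ℤ+ + 1) * zpow ri r n)

  -- signed area (1/2)·det(...) of the triangle with vertices
  -- (f n, f(n+k)), (f(n+2k), f(n+3k)), (f(n+4k), f(n+5k)); half plays the role of 1/2
  area : (a b r ri half : Carrier) → ℤ → ℤ → Carrier
  area a b r ri half n k =
    half * det2 (F (n ℤ+ (+ 2 ℤ* k)) - F n) (F (n ℤ+ (+ 3 ℤ* k)) - F (n ℤ+ k))
                (F (n ℤ+ (+ 4 ℤ* k)) - F n) (F (n ℤ+ (+ 5 ℤ* k)) - F (n ℤ+ k))
    where F = f a b r ri

  areaFormula : (a b r ri half : Carrier) → ℤ → ℤ → Carrier
  areaFormula a b r ri half n k =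
    (half * (a * b * sgn n)) * pow (rk - rik) 3 * (rk + rik) * (rk + sgn (k ℤ+ + 1) * rik)
    where rk  = zpow r ri k
          rik = zpow ri r k

-- Put A = a rⁿ, B = −b (−1)ⁿ r⁻ⁿ, u = rᵏ and v = (−1)ᵏ r⁻ᵏ.  Along the progression
-- n, n+k, n+2k, … the function is a sum of two geometric sequences, f(n+ik) = A uⁱ + B vⁱ,
-- and for any such sequence the determinant is the polynomial identity
--   AB (v − u)²(v + u)(u² − 1)(v² − 1).
-- Only the relations rⁿr⁻ⁿ = rᵏr⁻ᵏ = ((−1)ᵏ)² = 1 are then needed to reach the stated product,
-- so the argument runs in any commutative ring in which r has an inverse.

module Submission where

open import Level using (Level)
open import Algebra.Bundles using (CommutativeRing)
open import Algebra.Solver.Ring.AlmostCommutativeRing using (fromCommutativeRing; _-Raw-AlmostCommutative⟶_)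
open import Data.Maybe using (just; nothing)
open import Data.Nat as ℕ using (ℕ; zero; suc)
import Data.Nat.Properties as ℕ
open import Data.Integer as ℤ using (ℤ; +_; -[1+_]; _⊖_)
import Data.Integer.Properties as ℤ
import Data.Sign as Sign
open import Relation.Binary.Definitions using (WeaklyDecidable)
open import Relation.Binary.PropositionalEquality as ≡ using (cong)
import Relation.Binary.Reasoning.Setoid as SetoidReasoning
open import Relation.Nullary using (yes; no)

open import Defs

-- The ring solver is run with ℤ coefficients: with the ring as its own coefficient domain it
-- could not see that 1 − 1 = 0.  The cast uses the left-nested multiple _×_, for which
-- 1 × 1# is definitionally 1#, so the solver's constant con (+ 1) is literally 1#.
module IntegerCast {c ℓ : Level} (R : CommutativeRing c ℓ) where
  open CommutativeRing R
  open import Algebra.Properties.Ring ring using (-‿distribˡ-*; -‿distribʳ-*; -‿involutive; -0#≈0#)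
  open import Algebra.Properties.AbelianGroup +-abelianGroup using (⁻¹-∙-comm; xyx⁻¹≈y)
  open import Algebra.Properties.Semiring.Mult.TCOptimised semiring using (_×_; 1+×; ×-homo-+; ×1-homo-*)
  open import Relation.Binary.Reasoning.Setoid setoid

  fromℕ : ℕ → Carrier
  fromℕ n = n × 1#

  fromℤ : ℤ → Carrier
  fromℤ (+ n)    = fromℕ n
  fromℤ -[1+ n ] = - fromℕ (suc n)

  fromℤ-neg : ∀ i → fromℤ (ℤ.- i) ≈ - fromℤ i
  fromℤ-neg (+ zero)  = sym -0#≈0#
  fromℤ-neg (+ suc n) = refl
  fromℤ-neg -[1+ n ]  = sym (-‿involutive _)

  [x+y]-[x+z]≈y-z : ∀ x y z → (x + y) - (x + z) ≈ y - z
  [x+y]-[x+z]≈y-z x y z = begin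
    (x + y) - (x + z)     ≈⟨ +-congˡ (sym (⁻¹-∙-comm x z)) ⟩
    (x + y) + (- x - z)   ≈⟨ sym (+-assoc _ _ _) ⟩
    ((x + y) - x) - z     ≈⟨ +-congʳ (xyx⁻¹≈y x y) ⟩
    y - z                 ∎

  fromℤ-⊖ : ∀ m n → fromℤ (m ⊖ n) ≈ fromℕ m - fromℕ n
  fromℤ-⊖ m       zero    = sym (trans (+-congˡ -0#≈0#) (+-identityʳ _))
  fromℤ-⊖ zero    (suc n) = sym (+-identityˡ _)
  fromℤ-⊖ (suc m) (suc n) = begin
    fromℤ (suc m ⊖ suc n)                 ≡⟨ cong fromℤ (ℤ.[1+m]⊖[1+n]≡m⊖n m n) ⟩
    fromℤ (m ⊖ n)                         ≈⟨ fromℤ-⊖ m n ⟩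
    fromℕ m - fromℕ n                     ≈⟨ sym ([x+y]-[x+z]≈y-z 1# _ _) ⟩
    (1# + fromℕ m) - (1# + fromℕ n)       ≈⟨ sym (+-cong (1+× m 1#) (-‿cong (1+× n 1#))) ⟩
    fromℕ (suc m) - fromℕ (suc n)         ∎

  fromℤ-+ : ∀ i j → fromℤ (i ℤ.+ j) ≈ fromℤ i + fromℤ j
  fromℤ-+ (+ m)    (+ n)    = ×-homo-+ 1# m n
  fromℤ-+ (+ m)    -[1+ n ] = fromℤ-⊖ m (suc n)
  fromℤ-+ -[1+ m ] (+ n)    = trans (fromℤ-⊖ n (suc m)) (+-comm _ _)
  fromℤ-+ -[1+ m ] -[1+ n ] = begin
    - fromℕ (suc (suc (m ℕ.+ n)))         ≡⟨ cong (λ k → - fromℕ (suc k)) (ℕ.+-suc m n) ⟨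
    - fromℕ (suc m ℕ.+ suc n)             ≈⟨ -‿cong (×-homo-+ 1# (suc m) (suc n)) ⟩
    - (fromℕ (suc m) + fromℕ (suc n))     ≈⟨ ⁻¹-∙-comm _ _ ⟨
    - fromℕ (suc m) - fromℕ (suc n)       ∎

  fromℤ-+◃ : ∀ n → fromℤ (Sign.+ ℤ.◃ n) ≈ fromℕ n
  fromℤ-+◃ n = reflexive (cong fromℤ (ℤ.+◃n≡+n n))

  fromℤ--◃ : ∀ n → fromℤ (Sign.- ℤ.◃ n) ≈ - fromℕ n
  fromℤ--◃ n = trans (reflexive (cong fromℤ (ℤ.-◃n≡-n n))) (fromℤ-neg (+ n))

  fromℤ-* : ∀ i j → fromℤ (i ℤ.* j) ≈ fromℤ i * fromℤ j
  fromℤ-* (+ m)    (+ n)    = trans (fromℤ-+◃ (m ℕ.* n)) (×1-homo-* m n)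
  fromℤ-* (+ m)    -[1+ n ] = trans (fromℤ--◃ (m ℕ.* suc n))
    (trans (-‿cong (×1-homo-* m (suc n))) (-‿distribʳ-* _ _))
  fromℤ-* -[1+ m ] (+ n)    = trans (fromℤ--◃ (suc m ℕ.* n))
    (trans (-‿cong (×1-homo-* (suc m) n)) (-‿distribˡ-* _ _))
  fromℤ-* -[1+ m ] -[1+ n ] = begin
    fromℤ (Sign.+ ℤ.◃ (suc m ℕ.* suc n))  ≈⟨ fromℤ-+◃ (suc m ℕ.* suc n) ⟩
    fromℕ (suc m ℕ.* suc n)               ≈⟨ ×1-homo-* (suc m) (suc n) ⟩
    fromℕ (suc m) * fromℕ (suc n)         ≈⟨ -‿involutive _ ⟨
    - - (fromℕ (suc m) * fromℕ (suc n))   ≈⟨ -‿cong (-‿distribˡ-* _ _) ⟩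
    - (- fromℕ (suc m) * fromℕ (suc n))   ≈⟨ -‿distribʳ-* _ _ ⟩
    - fromℕ (suc m) * - fromℕ (suc n)     ∎

  fromℤ-homomorphism : ℤ.+-*-rawRing -Raw-AlmostCommutative⟶ fromCommutativeRing R
  fromℤ-homomorphism = record
    { ⟦_⟧    = fromℤ
    ; +-homo = fromℤ-+
    ; *-homo = fromℤ-*
    ; -‿homo = fromℤ-neg
    ; 0-homo = refl
    ; 1-homo = refl
    }

  fromℤ-≟ : WeaklyDecidable (λ i j → fromℤ i ≈ fromℤ j)
  fromℤ-≟ i j with i ℤ.≟ j
  ... | yes i≡j = just (reflexive (cong fromℤ i≡j))
  ... | no  _   = nothing

module IntegerRingSolver {c ℓ : Level} (R : CommutativeRing c ℓ) where
  open IntegerCast R using (fromℤ-homomorphism; fromℤ-≟)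
  open import Algebra.Solver.Ring ℤ.+-*-rawRing (fromCommutativeRing R) fromℤ-homomorphism fromℤ-≟ public

module UnitPowers {c ℓ : Level} (R : CommutativeRing c ℓ) where
  open CommutativeRing R
  open import Algebra.Properties.CommutativeSemigroup *-commutativeSemigroup using (interchange)
  open import Relation.Binary.Reasoning.Setoid setoid

  pow-+ : ∀ x m n → pow R x (m ℕ.+ n) ≈ pow R x m * pow R x n
  pow-+ x zero    n = sym (*-identityˡ _)
  pow-+ x (suc m) n = trans (*-congˡ (pow-+ x m n)) (sym (*-assoc _ _ _))

  pow-distrib-* : ∀ x y m → pow R (x * y) m ≈ pow R x m * pow R y m
  pow-distrib-* x y zero    = sym (*-identityʳ 1#)
  pow-distrib-* x y (suc m) = trans (*-congˡ (pow-distrib-* x y m)) (interchange x y _ _)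

  module _ {x xi : Carrier} (x*xi≈1 : x * xi ≈ 1#) where

    pow-inverse : ∀ m → pow R x m * pow R xi m ≈ 1#
    pow-inverse zero    = *-identityʳ 1#
    pow-inverse (suc m) = begin
      (x * pow R x m) * (xi * pow R xi m)  ≈⟨ interchange x _ xi _ ⟩
      (x * xi) * (pow R x m * pow R xi m)  ≈⟨ *-cong x*xi≈1 (pow-inverse m) ⟩
      1# * 1#                              ≈⟨ *-identityʳ 1# ⟩
      1#                                   ∎

    zpow-⊖ : ∀ m n → zpow R x xi (m ⊖ n) ≈ pow R x m * pow R xi n
    zpow-⊖ m       zero    = sym (*-identityʳ _)
    zpow-⊖ zero    (suc n) = sym (*-identityˡ _)
    zpow-⊖ (suc m) (suc n) = begin
      zpow R x xi (suc m ⊖ suc n)              ≡⟨ cong (zpow R x xi) (ℤ.[1+m]⊖[1+n]≡m⊖n m n) ⟩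
      zpow R x xi (m ⊖ n)                      ≈⟨ zpow-⊖ m n ⟩
      pow R x m * pow R xi n                   ≈⟨ *-identityˡ _ ⟨
      1# * (pow R x m * pow R xi n)            ≈⟨ *-congʳ x*xi≈1 ⟨
      (x * xi) * (pow R x m * pow R xi n)      ≈⟨ interchange x xi _ _ ⟩
      (x * pow R x m) * (xi * pow R xi n)      ∎

    zpow-+ : ∀ i j → zpow R x xi (i ℤ.+ j) ≈ zpow R x xi i * zpow R x xi j
    zpow-+ (+ m)    (+ n)    = pow-+ x m n
    zpow-+ (+ m)    -[1+ n ] = zpow-⊖ m (suc n)
    zpow-+ -[1+ m ] (+ n)    = trans (zpow-⊖ n (suc m)) (*-comm _ _)
    zpow-+ -[1+ m ] -[1+ n ] = begin
      pow R xi (suc (suc (m ℕ.+ n)))           ≡⟨ cong (λ l → pow R xi (suc l)) (ℕ.+-suc m n) ⟨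
      pow R xi (suc m ℕ.+ suc n)               ≈⟨ pow-+ xi (suc m) (suc n) ⟩
      pow R xi (suc m) * pow R xi (suc n)      ∎

    zpow-* : ∀ m i → zpow R x xi (+ m ℤ.* i) ≈ pow R (zpow R x xi i) m
    zpow-* zero    i = refl
    zpow-* (suc m) i = begin
      zpow R x xi (+ suc m ℤ.* i)               ≡⟨ cong (zpow R x xi) (ℤ.suc-* (+ m) i) ⟩
      zpow R x xi (i ℤ.+ + m ℤ.* i)             ≈⟨ zpow-+ i (+ m ℤ.* i) ⟩
      zpow R x xi i * zpow R x xi (+ m ℤ.* i)   ≈⟨ *-congˡ (zpow-* m i) ⟩
      zpow R x xi i * pow R (zpow R x xi i) m   ∎

    zpow-inverse : ∀ i → zpow R x xi i * zpow R xi x i ≈ 1#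
    zpow-inverse (+ m)    = pow-inverse m
    zpow-inverse -[1+ m ] = trans (*-comm _ _) (pow-inverse (suc m))

module AreaIdentities {c ℓ : Level} (R : CommutativeRing c ℓ) where
  open CommutativeRing R
  open import Algebra.Properties.Ring ring using (-1*x≈-x; -‿involutive)
  open import Algebra.Properties.Group +-group using (//-cong₂)
  open import Algebra.Properties.CommutativeSemigroup *-commutativeSemigroup using (interchange)
  open import Relation.Binary.Reasoning.Setoid setoid
  open IntegerRingSolver R
  open UnitPowers R

  geom₂ : (A B u v : Carrier) → ℕ → Carrier
  geom₂ A B u v i = A * pow R u i + B * pow R v i

  det2-cong : ∀ {p p′ q q′ s s′ t t′} → p ≈ p′ → q ≈ q′ → s ≈ s′ → t ≈ t′ →
              det2 R p q s t ≈ det2 R p′ q′ s′ t′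
  det2-cong p≈ q≈ s≈ t≈ = +-cong (*-cong p≈ t≈) (-‿cong (*-cong q≈ s≈))

  det2-geom₂ : ∀ A B u v → let G = geom₂ A B u v in
    det2 R (G 2 - G 0) (G 3 - G 1) (G 4 - G 0) (G 5 - G 1)
      ≈ A * B * (((v - u) * (v - u) * (v + u)) * ((u * u - 1#) * (v * v - 1#)))
  det2-geom₂ = solve 4 (λ A B u v →
    let G : ℕ → Polynomial 4
        G i = A :* u :^ i :+ B :* v :^ i
        one = con (+ 1)
    in  (G 2 :- G 0) :* (G 5 :- G 1) :- (G 3 :- G 1) :* (G 4 :- G 0)
          := A :* B :* (((v :- u) :* (v :- u) :* (v :+ u)) :* ((u :* u :- one) :* (v :* v :- one))))
    refl

  -1*-1≈1 : - 1# * - 1# ≈ 1#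
  -1*-1≈1 = trans (-1*x≈-x (- 1#)) (-‿involutive 1#)

  module _ {t : Carrier} (t*t≈1 : t * t ≈ 1#) where

    sign-square : ∀ y → (t * y) * (t * y) ≈ y * y
    sign-square y = trans (interchange t y t y) (trans (*-congʳ t*t≈1) (*-identityˡ _))

    cubic-factor : ∀ x y → (t * y - x) * (t * y - x) * (t * y + x) ≈ (x - y) * (x + y) * (x - t * y)
    cubic-factor x y = begin
      (t * y - x) * (t * y - x) * (t * y + x)     ≈⟨ solve 3 (λ t x y →
          (t :* y :- x) :* (t :* y :- x) :* (t :* y :+ x) := (x :- t :* y) :* (x :* x :- (t :* y) :* (t :* y)))
          refl t x y ⟩
      (x - t * y) * (x * x - (t * y) * (t * y))   ≈⟨ *-congˡ (+-congˡ (-‿cong (sign-square y))) ⟩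
      (x - t * y) * (x * x - y * y)               ≈⟨ solve 3 (λ t x y →
          (x :- t :* y) :* (x :* x :- y :* y) := (x :- y) :* (x :+ y) :* (x :- t :* y))
          refl t x y ⟩
      (x - y) * (x + y) * (x - t * y)             ∎

  module _ {x y : Carrier} (x*y≈1 : x * y ≈ 1#) where

    -- (x² − 1)(y² − 1) + (x − y)² = (xy − 1)²
    unit-pair-square : (x * x - 1#) * (y * y - 1#) ≈ - ((x - y) * (x - y))
    unit-pair-square = begin
      (x * x - 1#) * (y * y - 1#)                      ≈⟨ solve 2 (λ x y → let one = con (+ 1) in
          (x :* x :- one) :* (y :* y :- one) := :- ((x :- y) :* (x :- y)) :+ (x :* y :- one) :* (x :* y :- one))
          refl x y ⟩
      - ((x - y) * (x - y)) + (x * y - 1#) * (x * y - 1#) ≈⟨ +-congˡ (*-congʳ (trans (+-congʳ x*y≈1) (-‿inverseʳ 1#))) ⟩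
      - ((x - y) * (x - y)) + 0# * (x * y - 1#)         ≈⟨ +-congˡ (zeroˡ _) ⟩
      - ((x - y) * (x - y)) + 0#                        ≈⟨ +-identityʳ _ ⟩
      - ((x - y) * (x - y))                             ∎

  sgn-+ : ∀ i j → sgn R (i ℤ.+ j) ≈ sgn R i * sgn R j
  sgn-+ = zpow-+ -1*-1≈1

  module Progression {r ri : Carrier} (r*ri≈1 : r * ri ≈ 1#) (a b : Carrier) (n k : ℤ) where

    A B rᵏ r⁻ᵏ sᵏ : Carrier
    A   = a * zpow R r ri n
    B   = - (b * sgn R n * zpow R ri r n)
    rᵏ  = zpow R r ri k
    r⁻ᵏ = zpow R ri r k
    sᵏ  = sgn R k

    ri*r≈1 : ri * r ≈ 1#
    ri*r≈1 = trans (*-comm ri r) r*ri≈1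

    -- sgn R (+ 1) unfolds to - 1# * 1#, which the solver term con -[1+ 0 ] :^ 1 reproduces.
    f-shift : ∀ j → f R a b r ri (n ℤ.+ j) ≈ A * zpow R r ri j + B * (sgn R j * zpow R ri r j)
    f-shift j = begin
      a * zpow R r ri (n ℤ.+ j) + b * (sgn R (n ℤ.+ j ℤ.+ + 1) * zpow R ri r (n ℤ.+ j))
        ≈⟨ +-cong (*-congˡ (zpow-+ r*ri≈1 n j))
                  (*-congˡ (*-cong (trans (sgn-+ (n ℤ.+ j) (+ 1)) (*-congʳ (sgn-+ n j))) (zpow-+ ri*r≈1 n j))) ⟩
      a * (zpow R r ri n * zpow R r ri j)
        + b * (sgn R n * sgn R j * sgn R (+ 1) * (zpow R ri r n * zpow R ri r j))
        ≈⟨ solve 8 (λ a b u v s sʲ x y →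
             a :* (u :* x) :+ b :* (s :* sʲ :* con -[1+ 0 ] :^ 1 :* (v :* y))
               := a :* u :* x :+ :- (b :* s :* v) :* (sʲ :* y))
             refl a b (zpow R r ri n) (zpow R ri r n) (sgn R n) (sgn R j) (zpow R r ri j) (zpow R ri r j) ⟩
      A * zpow R r ri j + B * (sgn R j * zpow R ri r j) ∎

    f-on-progression : ∀ i → f R a b r ri (n ℤ.+ + i ℤ.* k) ≈ geom₂ A B rᵏ (sᵏ * r⁻ᵏ) i
    f-on-progression i = begin
      f R a b r ri (n ℤ.+ + i ℤ.* k)
        ≈⟨ f-shift (+ i ℤ.* k) ⟩
      A * zpow R r ri (+ i ℤ.* k) + B * (sgn R (+ i ℤ.* k) * zpow R ri r (+ i ℤ.* k))
        ≈⟨ +-cong (*-congˡ (zpow-* r*ri≈1 i k))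
                  (*-congˡ (trans (*-cong (zpow-* -1*-1≈1 i k) (zpow-* ri*r≈1 i k)) (sym (pow-distrib-* sᵏ r⁻ᵏ i)))) ⟩
      A * pow R rᵏ i + B * pow R (sᵏ * r⁻ᵏ) i
        ∎

    area-factorised : ∀ half → area R a b r ri half n k ≈
      half * (A * B * (((sᵏ * r⁻ᵏ - rᵏ) * (sᵏ * r⁻ᵏ - rᵏ) * (sᵏ * r⁻ᵏ + rᵏ))
                      * ((rᵏ * rᵏ - 1#) * ((sᵏ * r⁻ᵏ) * (sᵏ * r⁻ᵏ) - 1#))))
    area-factorised half = *-congˡ (trans
      (det2-cong (//-cong₂ (f-on-progression 2) f₀) (//-cong₂ (f-on-progression 3) f₁)
                 (//-cong₂ (f-on-progression 4) f₀) (//-cong₂ (f-on-progression 5) f₁))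
      (det2-geom₂ A B rᵏ (sᵏ * r⁻ᵏ)))
      where
      f₀ : f R a b r ri n ≈ geom₂ A B rᵏ (sᵏ * r⁻ᵏ) 0
      f₀ = trans (reflexive (cong (f R a b r ri) (≡.sym (ℤ.+-identityʳ n)))) (f-on-progression 0)
      f₁ : f R a b r ri (n ℤ.+ k) ≈ geom₂ A B rᵏ (sᵏ * r⁻ᵏ) 1
      f₁ = trans (reflexive (cong (λ j → f R a b r ri (n ℤ.+ j)) (≡.sym (ℤ.*-identityˡ k)))) (f-on-progression 1)

    A*B≈-ab·sgn : A * B ≈ - (a * b * sgn R n)
    A*B≈-ab·sgn = begin
      A * B                                              ≈⟨ solve 5 (λ a b s u v →
          a :* u :* :- (b :* s :* v) := :- (a :* b :* s :* (u :* v)))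
          refl a b (sgn R n) (zpow R r ri n) (zpow R ri r n) ⟩
      - (a * b * sgn R n * (zpow R r ri n * zpow R ri r n)) ≈⟨ -‿cong (*-congˡ (zpow-inverse r*ri≈1 n)) ⟩
      - (a * b * sgn R n * 1#)                           ≈⟨ -‿cong (*-identityʳ _) ⟩
      - (a * b * sgn R n)                                ∎

    area-factor-units : ((sᵏ * r⁻ᵏ - rᵏ) * (sᵏ * r⁻ᵏ - rᵏ) * (sᵏ * r⁻ᵏ + rᵏ))
                        * ((rᵏ * rᵏ - 1#) * ((sᵏ * r⁻ᵏ) * (sᵏ * r⁻ᵏ) - 1#))
      ≈ (rᵏ - r⁻ᵏ) * (rᵏ + r⁻ᵏ) * (rᵏ - sᵏ * r⁻ᵏ) * - ((rᵏ - r⁻ᵏ) * (rᵏ - r⁻ᵏ))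
    area-factor-units = *-cong (cubic-factor sᵏ*sᵏ≈1 rᵏ r⁻ᵏ)
      (trans (*-congˡ (+-congʳ (sign-square sᵏ*sᵏ≈1 r⁻ᵏ))) (unit-pair-square (zpow-inverse r*ri≈1 k)))
      where
      sᵏ*sᵏ≈1 : sᵏ * sᵏ ≈ 1#
      sᵏ*sᵏ≈1 = zpow-inverse -1*-1≈1 k

lemma2p2 : {c ℓ : Level} (R : CommutativeRing c ℓ) →
    (a b r ri half : CommutativeRing.Carrier R) →
    CommutativeRing._≈_ R (CommutativeRing._*_ R r ri) (CommutativeRing.1# R) →
    CommutativeRing._≈_ R (CommutativeRing._*_ R half (CommutativeRing._+_ R (CommutativeRing.1# R) (CommutativeRing.1# R))) (CommutativeRing.1# R) →
    (n k : ℤ) →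
    CommutativeRing._≈_ R (area R a b r ri half n k) (areaFormula R a b r ri half n k)
lemma2p2 R a b r ri half r*ri≈1 _ n k = begin
  area R a b r ri half n k
    ≈⟨ area-factorised half ⟩
  half * (A * B * (((sᵏ * r⁻ᵏ - rᵏ) * (sᵏ * r⁻ᵏ - rᵏ) * (sᵏ * r⁻ᵏ + rᵏ))
                  * ((rᵏ * rᵏ - 1#) * ((sᵏ * r⁻ᵏ) * (sᵏ * r⁻ᵏ) - 1#))))
    ≈⟨ *-congˡ (*-cong A*B≈-ab·sgn area-factor-units) ⟩
  half * (- (a * b * sgn R n) * ((rᵏ - r⁻ᵏ) * (rᵏ + r⁻ᵏ) * (rᵏ - sᵏ * r⁻ᵏ) * - ((rᵏ - r⁻ᵏ) * (rᵏ - r⁻ᵏ))))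
    ≈⟨ solve 5 (λ h q x y s →
         h :* (:- q :* ((x :- y) :* (x :+ y) :* (x :- s :* y) :* :- ((x :- y) :* (x :- y))))
           := h :* q :* (x :- y) :^ 3 :* (x :+ y) :* (x :+ s :* con -[1+ 0 ] :^ 1 :* y))
         refl half (a * b * sgn R n) rᵏ r⁻ᵏ sᵏ ⟩
  half * (a * b * sgn R n) * pow R (rᵏ - r⁻ᵏ) 3 * (rᵏ + r⁻ᵏ) * (rᵏ + sᵏ * sgn R (+ 1) * r⁻ᵏ)
    ≈⟨ *-congˡ (+-congˡ (*-congʳ (sgn-+ k (+ 1)))) ⟨
  areaFormula R a b r ri half n k
    ∎
  where
  open CommutativeRing R
  open SetoidReasoning setoid
  open IntegerRingSolver R
  open AreaIdentities R
  open Progression r*ri≈1 a b n k
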